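{- Let $q\colon M\to N$ be a surjective monoid homomorphism, let $\mathbf{K}$ be an order-enriched category whose hom-posets admit arbitrary non-empty suprema and whose composition preserves them in each argument (i.e. $f\circ(\bigvee_i g_i)=\bigvee_i f\circ g_i$ and $(\bigvee_i g_i)\circ f=\bigvee_i g_i\circ f$ for non-empty families), and let $J\colon\mathbf{J}\to\mathbf{K}$ exhibit a wide subcategory. Then for every $\pi\in[\mathbf{M},\mathbf{K}]^J$ and every $n\in N$, $$\Sigma_q(\pi)_n=\bigvee\{\pi_m\mid m\in M,\ q(m)=n\}.$$
   Context: Order-enriched category: hom-sets partially ordered, composition monotone. A monoid $M$ is regarded as a one-object category $\mathbf{M}$. A lax functor $\pi$ from $\mathbf{M}$ to $\mathbf{K}$ is an object $\pi(\ast)$ with endomorphisms $\pi_m$ ($m\in M$) satisfying $id_{\pi(\ast)}\leq\pi_1$ and $\pi_m\circ\pi_{m'}\leq\pi_{m\cdot m'}$. $[\mathbf{M},\mathbf{K}]^J$ denotes the category of such lax functors with morphisms $\pi\to\pi'$ the morphisms $f\colon\pi(\ast)\to\pi'(\ast)$ of $\mathbf{J}$ with $J(f)\circ\pi_m\leq\pi'_m\circ J(f)$ for all $m$. The $q$-saturation $\Sigma_q(\pi)$ of $\pi\in[\mathbf{M},\mathbf{K}]^J$ is the lax functor from $\mathbf{N}$ with $\Sigma_q(\pi)(\ast)=\pi(\ast)$ and $\Sigma_q(\pi)_n=\bigvee_{i<\omega}\Pi_{n,i}$, where $\Pi_{n,0}=\bigvee\{\pi_m\mid q(m)=n\}$ and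 $\Pi_{n,i+1}=\bigvee\{\Pi_{n_1,i}\circ\cdots\circ\Pi_{n_l,i}\mid l\ge1,\ n_1\cdot\ldots\cdot n_l=n\}$ (this is a left strict 2-adjoint to the change-of-base functor $\pi'\mapsto\pi'\circ q$). -}

module Defs where

open import Level using (Level; _⊔_; suc; Lift; lift)
open import Data.Nat using (ℕ; zero) renaming (suc to sucℕ)
open import Data.Product using (Σ; _,_; proj₁; proj₂)
open import Data.List.NonEmpty using (List⁺; [_]; foldr₁) renaming (map to map⁺)
open import Relation.Binary.Structures using (IsPartialOrder)
open import Algebra.Bundles using (Monoid)
open import Algebra.Morphism.Structures using (module MonoidMorphisms)

-- Non-emptiness of the index type is witnessed by an
-- (irrelevant) inhabitant, so the supremum does not depend on it.

record SupEnrichedCategory (o h r ι : Level) : Set (suc (o ⊔ h ⊔ r ⊔ ι)) where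
  infixr 9 _∘_
  infix  4 _≈_ _≤_
  field
    Obj  : Set o
    Hom  : Obj → Obj → Set h
    _≈_  : ∀ {A B} → Hom A B → Hom A B → Set r
    _≤_  : ∀ {A B} → Hom A B → Hom A B → Set r
    isPartialOrder : ∀ {A B} → IsPartialOrder (_≈_ {A} {B}) _≤_
    id   : ∀ {A} → Hom A A
    _∘_  : ∀ {A B C} → Hom B C → Hom A B → Hom A C
    assoc     : ∀ {A B C D} {f : Hom A B} {g : Hom B C} {k : Hom C D} →
                (k ∘ g) ∘ f ≈ k ∘ (g ∘ f)
    identityˡ : ∀ {A B} {f : Hom A B} → id ∘ f ≈ f
    identityʳ : ∀ {A B} {f : Hom A B} → f ∘ id ≈ f
    ∘-resp-≈  : ∀ {A B C} {f f' : Hom B C} {g g' : Hom A B} →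
                f ≈ f' → g ≈ g' → f ∘ g ≈ f' ∘ g'
    ∘-mono-≤  : ∀ {A B C} {f f' : Hom B C} {g g' : Hom A B} →
                f ≤ f' → g ≤ g' → f ∘ g ≤ f' ∘ g'
    ⋁    : ∀ {A B} {I : Set ι} → .I → (I → Hom A B) → Hom A B
    ⋁-upper : ∀ {A B} {I : Set ι} .(w : I) (f : I → Hom A B) (i : I) →
              f i ≤ ⋁ w f
    ⋁-least : ∀ {A B} {I : Set ι} .(w : I) (f : I → Hom A B) (u : Hom A B) →
              (∀ i → f i ≤ u) → ⋁ w f ≤ u
    ∘-⋁ˡ : ∀ {A B C} {I : Set ι} .(w : I) (f : Hom B C) (g : I → Hom A B) →
           f ∘ ⋁ w g ≈ ⋁ w (λ i → f ∘ g i)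
    ∘-⋁ʳ : ∀ {A B C} {I : Set ι} .(w : I) (g : I → Hom B C) (f : Hom A B) →
           ⋁ w g ∘ f ≈ ⋁ w (λ i → g i ∘ f)

record WideSubcategory {o h r ι} (K : SupEnrichedCategory o h r ι) (j : Level)
       : Set (o ⊔ h ⊔ r ⊔ suc j) where
  open SupEnrichedCategory K
  field
    InJ      : ∀ {A B} → Hom A B → Set j
    InJ-resp : ∀ {A B} {f g : Hom A B} → f ≈ g → InJ f → InJ g
    InJ-id   : ∀ {A} → InJ (id {A})
    InJ-∘    : ∀ {A B C} {f : Hom B C} {g : Hom A B} → InJ f → InJ g → InJ (f ∘ g)

record LaxFunctor {c ℓ o h r ι} (M : Monoid c ℓ) (K : SupEnrichedCategory o h r ι)
       : Set (c ⊔ ℓ ⊔ o ⊔ h ⊔ r) where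
  open SupEnrichedCategory K
  module M = Monoid M
  field
    obj  : Obj
    act  : M.Carrier → Hom obj obj
    act-resp : ∀ {m m'} → m M.≈ m' → act m ≈ act m'
    unit : id ≤ act M.ε
    mult : ∀ m m' → act m ∘ act m' ≤ act (m M.∙ m')

-- Objects of [M, K]^J are exactly the lax functors M → K
-- (J only affects the morphisms of [M, K]^J).
Obj[_,_]^_ : ∀ {c ℓ o h r ι j} (M : Monoid c ℓ) (K : SupEnrichedCategory o h r ι) →
             WideSubcategory K j → Set (c ⊔ ℓ ⊔ o ⊔ h ⊔ r)
Obj[ M , K ]^ J = LaxFunctor M K

IsMonoidHom : ∀ {c₁ ℓ₁ c₂ ℓ₂} (M : Monoid c₁ ℓ₁) (N : Monoid c₂ ℓ₂) →
              (Monoid.Carrier M → Monoid.Carrier N) → Set (c₁ ⊔ ℓ₁ ⊔ ℓ₂)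
IsMonoidHom M N = MonoidMorphisms.IsMonoidHomomorphism (Monoid.rawMonoid M) (Monoid.rawMonoid N)

IsSurjective : ∀ {c₁ ℓ₁ c₂ ℓ₂} (M : Monoid c₁ ℓ₁) (N : Monoid c₂ ℓ₂) →
               (Monoid.Carrier M → Monoid.Carrier N) → Set (c₁ ⊔ c₂ ⊔ ℓ₂)
IsSurjective M N q = ∀ n → Σ (Monoid.Carrier M) (λ m → Monoid._≈_ N (q m) n)

module Saturation {c₁ ℓ₁ c₂ ℓ₂ o h r}
  (M : Monoid c₁ ℓ₁) (N : Monoid c₂ ℓ₂)
  (K : SupEnrichedCategory o h r (c₁ ⊔ ℓ₁ ⊔ c₂ ⊔ ℓ₂))
  (q : Monoid.Carrier M → Monoid.Carrier N)
  (q-surj : IsSurjective M N q)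
  (π : LaxFunctor M K) where

  open SupEnrichedCategory K
  private
    module M = Monoid M
    module N = Monoid N
    module π = LaxFunctor π
    ι = c₁ ⊔ ℓ₁ ⊔ c₂ ⊔ ℓ₂

  X : Obj
  X = π.obj

  Fibre : N.Carrier → Set ι
  Fibre n = Lift ι (Σ M.Carrier (λ m → q m N.≈ n))

  fibreAct : ∀ n → Fibre n → Hom X X
  fibreAct n (lift (m , _)) = π.act m

  Factorisations : N.Carrier → Set ι
  Factorisations n = Lift ι (Σ (List⁺ N.Carrier) (λ ns → foldr₁ N._∙_ ns N.≈ n))

  Π : ℕ → N.Carrier → Hom X X
  Π zero     n = ⋁ {I = Fibre n} (lift (q-surj n)) (fibreAct n)
  Π (sucℕ i) n = ⋁ {I = Factorisations n} (lift ([ n ] , N.refl))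
                   (λ { (lift (ns , _)) → foldr₁ _∘_ (map⁺ (Π i) ns) })

  Σq : N.Carrier → Hom X X
  Σq n = ⋁ {I = Lift ι ℕ} (lift zero) (λ { (lift i) → Π i n })

module Submission where

-- Write  F n = ⋁ {π_m | q m = n}  for the right-hand side.
-- Since Π_{n,0} = F n and Σ_q(π)_n = ⋁_i Π_{n,i}, one inequality is immediate;
-- for the other it suffices that every Π_{n,i} lies below F n.  The key fact is
-- that F is itself submultiplicative,  F a ∘ F b ≤ F (a · b):  composition
-- distributes over the two suprema, π is lax, and q is a homomorphism.  Hence
-- any family G ≤ F composed along a factorisation n₁ · … · n_l = n stays below
-- F n, and induction on i gives Π_{n,i} ≤ F n.

open import Defs
open import Level using (_⊔_; lift)
open import Algebra.Bundles using (Monoid)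
open import Data.Nat using (zero) renaming (suc to sucℕ)
open import Data.Product using (_,_)
open import Data.List using ([]; _∷_)
open import Data.List.NonEmpty using (_∷_; foldr₁) renaming (map to map⁺)
open import Relation.Binary.Structures using (IsPartialOrder)
open import Algebra.Morphism.Structures using (module MonoidMorphisms)

module SupFacts {o h r ι} (K : SupEnrichedCategory o h r ι) where
  open SupEnrichedCategory K
  module ≤-PO {A B} = IsPartialOrder (isPartialOrder {A} {B})
  open ≤-PO public using (antisym) renaming (trans to ≤-trans; reflexive to ≈⇒≤)

  ⋁∘⋁-least : ∀ {A B C} {I I' : Set ι} .(w : I) .(w' : I')
              (f : I → Hom B C) (g : I' → Hom A B) (u : Hom A C) →
              (∀ i i' → f i ∘ g i' ≤ u) → ⋁ w f ∘ ⋁ w' g ≤ u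
  ⋁∘⋁-least w w' f g u bound =
    ≤-trans (≈⇒≤ (∘-⋁ʳ w f (⋁ w' g))) (⋁-least w _ u λ i →
      ≤-trans (≈⇒≤ (∘-⋁ˡ w' (f i) g)) (⋁-least w' _ u (bound i)))

module SubmultiplicativeBound {o h r ι c ℓ} (K : SupEnrichedCategory o h r ι)
    (N : Monoid c ℓ) {X : SupEnrichedCategory.Obj K}
    (H : Monoid.Carrier N → SupEnrichedCategory.Hom K X X)
    (H-mult : ∀ a b → SupEnrichedCategory._≤_ K
                (SupEnrichedCategory._∘_ K (H a) (H b)) (H (Monoid._∙_ N a b))) where
  open SupEnrichedCategory K
  open SupFacts K
  private module N = Monoid N

  composite-bound : (G : N.Carrier → Hom X X) → (∀ a → G a ≤ H a) →
                    ∀ ns → foldr₁ _∘_ (map⁺ G ns) ≤ H (foldr₁ N._∙_ ns)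
  composite-bound G G≤H (a ∷ as) = bound-from a as
    where
    -- recursion on the tail of the list, so that termination is structural
    bound-from : ∀ a as → foldr₁ _∘_ (map⁺ G (a ∷ as)) ≤ H (foldr₁ N._∙_ (a ∷ as))
    bound-from a []       = G≤H a
    bound-from a (b ∷ bs) = ≤-trans (∘-mono-≤ (G≤H a) (bound-from b bs)) (H-mult a _)

module SaturationBound {c₁ ℓ₁ c₂ ℓ₂ o h r} (M : Monoid c₁ ℓ₁) (N : Monoid c₂ ℓ₂)
    (q : Monoid.Carrier M → Monoid.Carrier N) (q-hom : IsMonoidHom M N q)
    (q-surj : IsSurjective M N q)
    (K : SupEnrichedCategory o h r (c₁ ⊔ ℓ₁ ⊔ c₂ ⊔ ℓ₂)) (π : LaxFunctor M K) where
  open SupEnrichedCategory K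
  open SupFacts K
  open Saturation M N K q q-surj π
  private
    module M = Monoid M
    module N = Monoid N
    module π = LaxFunctor π
  open MonoidMorphisms.IsMonoidHomomorphism q-hom using (homo)

  F : N.Carrier → Hom X X
  F n = ⋁ (lift (q-surj n)) (fibreAct n)

  F-resp : ∀ {a b} → a N.≈ b → F a ≤ F b
  F-resp {a} {b} a≈b = ⋁-least _ (fibreAct a) (F b)
    λ { (lift (m , qm≈a)) → ⋁-upper _ (fibreAct b) (lift (m , N.trans qm≈a a≈b)) }

  -- F is submultiplicative: π_x ∘ π_y ≤ π_{x·y} and q (x·y) = q x · q y.
  F-mult : ∀ a b → F a ∘ F b ≤ F (a N.∙ b)
  F-mult a b = ⋁∘⋁-least _ _ (fibreAct a) (fibreAct b) (F (a N.∙ b))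
    λ { (lift (x , qx≈a)) (lift (y , qy≈b)) →
        ≤-trans (π.mult x y)
          (⋁-upper _ (fibreAct (a N.∙ b))
            (lift (x M.∙ y , N.trans (homo x y) (N.∙-cong qx≈a qy≈b)))) }

  open SubmultiplicativeBound K N F F-mult

  Π≤F : ∀ i n → Π i n ≤ F n
  Π≤F zero     n = ≤-PO.refl
  Π≤F (sucℕ i) n = ⋁-least _ _ (F n)
    λ { (lift (ns , prod≈n)) →
        ≤-trans (composite-bound (Π i) (Π≤F i) ns) (F-resp prod≈n) }

  Σq≈F : ∀ n → Σq n ≈ F n
  Σq≈F n = antisym (⋁-least _ _ (F n) λ { (lift i) → Π≤F i n })
                   (⋁-upper _ (λ { (lift i) → Π i n }) (lift zero))

theorem4p3 : ∀ {c₁ ℓ₁ c₂ ℓ₂ o h r j} (M : Monoid c₁ ℓ₁) (N : Monoid c₂ ℓ₂)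
    (q : Monoid.Carrier M → Monoid.Carrier N) (q-hom : IsMonoidHom M N q)
    (q-surj : IsSurjective M N q)
    (K : SupEnrichedCategory o h r (c₁ ⊔ ℓ₁ ⊔ c₂ ⊔ ℓ₂)) (J : WideSubcategory K j)
    (π : Obj[ M , K ]^ J) (n : Monoid.Carrier N) →
    SupEnrichedCategory._≈_ K (Saturation.Σq M N K q q-surj π n)
    (SupEnrichedCategory.⋁ K (lift (q-surj n)) (Saturation.fibreAct M N K q q-surj π n))
theorem4p3 M N q q-hom q-surj K _ π = SaturationBound.Σq≈F M N q q-hom q-surj K π
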